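{- For every $k\ge 1$, the $k$-snake is both 1-in-degenerate and 1-out-degenerate.
   Context: The $k$-snake is the tournament on vertices $v_1,\dots,v_k$ such that, with respect to the ordering $(v_1,\dots,v_k)$, the backedge graph has edge set $\{v_iv_{i+1}: i\in[k-1]\}$; here an arc $v_i\to v_j$ is a backedge if $i>j$, and the backedge graph is the undirected graph whose edges are the pairs $v_iv_j$ with $(v_i,v_j)$ a backedge. Thus $v_{i+1}\to v_i$ for all $i\in[k-1]$ and $v_i\to v_j$ whenever $j\ge i+2$. A tournament is 1-out-degenerate (resp. 1-in-degenerate) if every (nonempty) subtournament has a vertex of out-degree (resp. in-degree) at most $1$ within that subtournament. -}

module Defs where

open import Data.Nat using (ℕ; suc; _≤_)
open import Data.Nat.Properties using (_≟_; _≤?_)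
open import Data.Fin using (Fin; toℕ)
open import Data.Fin.Subset using (Subset; _∈_; _∩_; ∣_∣; Nonempty)
open import Data.Vec using (tabulate)
open import Data.Bool using (Bool)
open import Data.Product using (∃; _×_)
open import Data.Sum using (_⊎_)
open import Data.Empty using (⊥)
open import Relation.Nullary using (Dec; ¬_; does)
open import Relation.Nullary.Decidable using (_⊎-dec_)
open import Relation.Binary.PropositionalEquality using (_≡_)

record Tournament (n : ℕ) : Set₁ where
  field
    _⇒_      : Fin n → Fin n → Set
    arc?     : ∀ u v → Dec (u ⇒ v)
    irrefl   : ∀ u → ¬ (u ⇒ u)
    asym     : ∀ u v → u ⇒ v → ¬ (v ⇒ u)
    total    : ∀ u v → ¬ (u ≡ v) → (u ⇒ v) ⊎ (v ⇒ u)

open Tournament public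

outNbhd : ∀ {n} → Tournament n → Fin n → Subset n
outNbhd T v = tabulate (λ u → does (arc? T v u))

inNbhd : ∀ {n} → Tournament n → Fin n → Subset n
inNbhd T v = tabulate (λ u → does (arc? T u v))

outDegIn : ∀ {n} → Tournament n → Subset n → Fin n → ℕ
outDegIn T S v = ∣ S ∩ outNbhd T v ∣

inDegIn : ∀ {n} → Tournament n → Subset n → Fin n → ℕ
inDegIn T S v = ∣ S ∩ inNbhd T v ∣

OneOutDegenerate : ∀ {n} → Tournament n → Set
OneOutDegenerate {n} T =
  (S : Subset n) → Nonempty S → ∃ λ v → v ∈ S × outDegIn T S v ≤ 1

OneInDegenerate : ∀ {n} → Tournament n → Set
OneInDegenerate {n} T =
  (S : Subset n) → Nonempty S → ∃ λ v → v ∈ S × inDegIn T S v ≤ 1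

-- The k-snake on v_1..v_k, here indexed 0..k-1 by Fin k:
-- v_{i+1} → v_i (backedges) and v_i → v_j whenever j ≥ i + 2.
SnakeArc : ∀ {k} → Fin k → Fin k → Set
SnakeArc i j = (toℕ i ≡ suc (toℕ j)) ⊎ (suc (suc (toℕ i)) ≤ toℕ j)

snakeArc? : ∀ {k} (i j : Fin k) → Dec (SnakeArc i j)
snakeArc? i j = (toℕ i ≟ suc (toℕ j)) ⊎-dec (suc (suc (toℕ i)) ≤? toℕ j)

private
  open import Data.Nat.Properties as ℕP using ()
  open import Data.Sum using (inj₁; inj₂)
  open import Data.Fin.Properties using (toℕ-injective)
  open import Relation.Binary.PropositionalEquality using (refl; sym; trans; cong)
  open import Relation.Binary.Definitions using (tri<; tri≈; tri>)
  open import Data.Nat using (_<_)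
  open import Data.Empty using (⊥-elim)

  cyc : ∀ {a b} → a < b → b ≤ a → ⊥
  cyc p q = ℕP.<-irrefl refl (ℕP.<-≤-trans p q)

  sn-irrefl : ∀ {k} (u : Fin k) → ¬ SnakeArc u u
  sn-irrefl u (inj₁ e) = ℕP.1+n≢n (sym e)
  sn-irrefl u (inj₂ p) = cyc (ℕP.≤-trans (ℕP.n≤1+n _) p) ℕP.≤-refl

  sn-asym : ∀ {k} (u v : Fin k) → SnakeArc u v → ¬ SnakeArc v u
  sn-asym u v (inj₁ e) (inj₁ f) =
    cyc {toℕ v} {toℕ u} (ℕP.≤-reflexive (sym e)) (ℕP.≤-trans (ℕP.n≤1+n _) (ℕP.≤-reflexive (sym f)))
  sn-asym u v (inj₁ e) (inj₂ p) = cyc p (ℕP.≤-reflexive e)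
  sn-asym u v (inj₂ p) (inj₁ e) = cyc p (ℕP.≤-reflexive e)
  sn-asym u v (inj₂ p) (inj₂ q) =
    cyc {toℕ u} {toℕ v} (ℕP.≤-trans (ℕP.n≤1+n _) p) (ℕP.≤-trans (ℕP.n≤1+n _) (ℕP.≤-trans (ℕP.n≤1+n _) q))

  sn-total : ∀ {k} (u v : Fin k) → ¬ (u ≡ v) → SnakeArc u v ⊎ SnakeArc v u
  sn-total u v ne with ℕP.<-cmp (toℕ u) (toℕ v)
  ... | tri≈ _ e _ = ⊥-elim (ne (toℕ-injective e))
  ... | tri< lt _ _ with ℕP.m≤n⇒m<n∨m≡n lt
  ...   | inj₁ lt2 = inj₁ (inj₂ lt2)
  ...   | inj₂ e = inj₂ (inj₁ (sym e))
  sn-total u v ne | tri> _ _ gt with ℕP.m≤n⇒m<n∨m≡n gt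
  ...   | inj₁ lt2 = inj₂ (inj₂ lt2)
  ...   | inj₂ e = inj₁ (inj₁ (sym e))

snake : (k : ℕ) → Tournament k
snake k = record
  { _⇒_ = SnakeArc ; arc? = snakeArc? ; irrefl = sn-irrefl
  ; asym = sn-asym ; total = sn-total }

-- In the snake every arc x → y with y ≤ x is a backedge, so x = y + 1. Hence in a
-- nonempty vertex set S the least vertex has at most one in-neighbour in S (its
-- successor) and the greatest vertex at most one out-neighbour in S (its predecessor).
module Submission where

open import Defs
open import Data.Empty using (⊥-elim)
open import Data.Fin as Fin using (Fin; toℕ)
open import Data.Fin.Properties using (toℕ-injective)
open import Data.Fin.Subset using (Subset; _∈_; _∩_; ∣_∣; Nonempty; ⁅_⁆; inside; outside)
open import Data.Fin.Subset.Properties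
  using (nonempty?; Empty-unique; ∣⊥∣≡0; x∈⁅x⁆; ∣⁅x⁆∣≡1; p⊆q⇒∣p∣≤∣q∣; x∈p∩q⁻)
open import Data.Nat using (ℕ; suc; _≤_; _≥_; z≤n; s≤s)
open import Data.Nat.Properties using (≤-trans; ≤-reflexive; n≤1+n; m≤n⇒m≤1+n; <⇒≱; suc-injective)
open import Data.Product using (∃; _×_; _,_)
open import Data.Sum using (inj₁; inj₂)
open import Data.Vec using (tabulate; _∷_)
open import Data.Vec.Base using (here; there)
open import Data.Vec.Properties using ([]=⇒lookup; lookup∘tabulate)
open import Function using (_∘_)
open import Relation.Nullary using (Dec; does; yes; no)
open import Relation.Binary.PropositionalEquality using (_≡_; sym; trans; subst)

private
  variable
    n : ℕ

subsingleton⇒∣p∣≤1 : {p : Subset n} → (∀ {x y} → x ∈ p → y ∈ p → x ≡ y) → ∣ p ∣ ≤ 1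
subsingleton⇒∣p∣≤1 {n} {p} unique with nonempty? p
... | yes (x , x∈p) = ≤-trans (p⊆q⇒∣p∣≤∣q∣ p⊆⁅x⁆) (≤-reflexive (∣⁅x⁆∣≡1 x))
  where
  p⊆⁅x⁆ : ∀ {y} → y ∈ p → y ∈ ⁅ x ⁆
  p⊆⁅x⁆ y∈p = subst (_∈ ⁅ x ⁆) (unique x∈p y∈p) (x∈⁅x⁆ x)
... | no p-empty = subst (λ q → ∣ q ∣ ≤ 1) (sym (Empty-unique p-empty)) (m≤n⇒m≤1+n (≤-reflexive (∣⊥∣≡0 n)))

nonempty⇒least : (S : Subset n) → Nonempty S → ∃ λ m → m ∈ S × (∀ {x} → x ∈ S → m Fin.≤ x)
nonempty⇒least (inside ∷ S) _ = Fin.zero , here , λ _ → z≤n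
nonempty⇒least (outside ∷ S) (Fin.suc x , there x∈S) with nonempty⇒least S (x , x∈S)
... | m , m∈S , m-least = Fin.suc m , there m∈S , λ { (there y∈S) → s≤s (m-least y∈S) }

nonempty⇒greatest : (S : Subset n) → Nonempty S → ∃ λ m → m ∈ S × (∀ {x} → x ∈ S → x Fin.≤ m)
nonempty⇒greatest (b ∷ S) S-nonempty with nonempty? S
... | yes tail-nonempty with nonempty⇒greatest S tail-nonempty
...   | m , m∈S , m-greatest = Fin.suc m , there m∈S , λ { here → z≤n ; (there y∈S) → s≤s (m-greatest y∈S) }
nonempty⇒greatest (b ∷ S) (Fin.zero , z∈S) | no tail-empty =
  Fin.zero , z∈S , λ { here → z≤n ; (there y∈S) → ⊥-elim (tail-empty (_ , y∈S)) }
nonempty⇒greatest (b ∷ S) (Fin.suc x , there x∈S) | no tail-empty = ⊥-elim (tail-empty (x , x∈S))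

∈-tabulate-does : {P : Fin n → Set} (P? : ∀ x → Dec (P x)) {x : Fin n} →
                  x ∈ tabulate (does ∘ P?) → P x
∈-tabulate-does P? {x} x∈
  with P? x | trans (sym (lookup∘tabulate (does ∘ P?) x)) ([]=⇒lookup x∈)
... | yes px | _  = px
... | no _   | ()

∈outNbhd⇒arc : (T : Tournament n) {v x : Fin n} → x ∈ outNbhd T v → _⇒_ T v x
∈outNbhd⇒arc T {v} = ∈-tabulate-does (arc? T v)

∈inNbhd⇒arc : (T : Tournament n) {v x : Fin n} → x ∈ inNbhd T v → _⇒_ T x v
∈inNbhd⇒arc T {v} = ∈-tabulate-does (λ u → arc? T u v)

snakeArc-backward⇒backedge : {i j : Fin n} → SnakeArc i j → j Fin.≤ i → toℕ i ≡ suc (toℕ j)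
snakeArc-backward⇒backedge (inj₁ i≡1+j) _   = i≡1+j
snakeArc-backward⇒backedge (inj₂ 2+i≤j) j≤i = ⊥-elim (<⇒≱ (≤-trans (n≤1+n _) 2+i≤j) j≤i)

snake-inDegIn-least : {S : Subset n} {m : Fin n} → (∀ {x} → x ∈ S → m Fin.≤ x) →
                      inDegIn (snake n) S m ≤ 1
snake-inDegIn-least {n} {S} {m} m-least =
  subsingleton⇒∣p∣≤1 λ x∈ y∈ → toℕ-injective (trans (successor x∈) (sym (successor y∈)))
  where
  successor : ∀ {x} → x ∈ S ∩ inNbhd (snake n) m → toℕ x ≡ suc (toℕ m)
  successor x∈ with x∈p∩q⁻ S _ x∈
  ... | x∈S , x⇒m = snakeArc-backward⇒backedge (∈inNbhd⇒arc (snake n) x⇒m) (m-least x∈S)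

snake-outDegIn-greatest : {S : Subset n} {m : Fin n} → (∀ {x} → x ∈ S → x Fin.≤ m) →
                          outDegIn (snake n) S m ≤ 1
snake-outDegIn-greatest {n} {S} {m} m-greatest =
  subsingleton⇒∣p∣≤1 λ x∈ y∈ → toℕ-injective (suc-injective (trans (sym (predecessor x∈)) (predecessor y∈)))
  where
  predecessor : ∀ {x} → x ∈ S ∩ outNbhd (snake n) m → toℕ m ≡ suc (toℕ x)
  predecessor x∈ with x∈p∩q⁻ S _ x∈
  ... | x∈S , m⇒x = snakeArc-backward⇒backedge (∈outNbhd⇒arc (snake n) m⇒x) (m-greatest x∈S)

snake-oneInDegenerate : (k : ℕ) → OneInDegenerate (snake k)
snake-oneInDegenerate k S S-nonempty with nonempty⇒least S S-nonempty
... | m , m∈S , m-least = m , m∈S , snake-inDegIn-least m-least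

snake-oneOutDegenerate : (k : ℕ) → OneOutDegenerate (snake k)
snake-oneOutDegenerate k S S-nonempty with nonempty⇒greatest S S-nonempty
... | m , m∈S , m-greatest = m , m∈S , snake-outDegIn-greatest m-greatest

theorem3p2p2 : (k : ℕ) → k ≥ 1 → OneInDegenerate (snake k) × OneOutDegenerate (snake k)
theorem3p2p2 k _ = snake-oneInDegenerate k , snake-oneOutDegenerate k
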